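{- Let $p_0$ be an odd prime, $p$ a power of $p_0$, $R(x) = 2x^p + x$, and $\zeta \in \mathbb{F}^\times$. Let $\xi \in \mathbb{F}^\times$ satisfy $\zeta^p\xi^{p^2} + \zeta^p\xi^p + \zeta\xi = 0$, and let $d \geq 1$ be such that $\xi, \zeta \in \mathbb{F}_{p^d}$. Then the affine curve $C_{\zeta R}: z^p - z = x\zeta R(x)$ is isomorphic over $\mathbb{F}_{p^d}$ to the affine curve $C': y^p - y = -\zeta\xi^{p+1}(x^p - x)^2$.
   Context: $\mathbb{F}$ is an algebraic closure of $\mathbb{F}_{p_0}$. -}

module Defs where

open import Level using (Level; _⊔_)
open import Algebra.Bundles using (CommutativeRing)
open import Data.Nat using (ℕ; zero; suc)
open import Data.List using (List; []; _∷_; length)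
open import Data.List.Relation.Unary.All using (All)
open import Data.Product using (_×_; Σ; ∃; _,_)
open import Relation.Nullary using (¬_)

-- Elementary field-theoretic notions over a commutative ring (the standard
-- library has no bundle for fields, so "is a field" is a predicate here).
module FieldDefs {c ℓ : Level} (F : CommutativeRing c ℓ) where
  open CommutativeRing F

  infixr 8 _^_
  _^_ : Carrier → ℕ → Carrier
  x ^ zero  = 1#
  x ^ suc n = x * (x ^ n)

  infixr 7 _·_
  _·_ : ℕ → Carrier → Carrier
  zero  · x = 0#
  suc n · x = x + (n · x)

  IsField : Set (c ⊔ ℓ)
  IsField = (¬ (1# ≈ 0#)) × (∀ x → ¬ (x ≈ 0#) → ∃ λ y → x * y ≈ 1#)

  evalPoly : List Carrier → Carrier → Carrier
  evalPoly []       x = 0#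
  evalPoly (a ∷ as) x = a + x * evalPoly as x

  -- the monic polynomial  X^(m+1) + a_m X^m + … + a₀  of degree m+1 ≥ 1, where as = a₀ … a_m
  evalMonic : List Carrier → Carrier → Carrier
  evalMonic as x = (x ^ suc (length as)) + evalPoly as x

  -- every nonconstant (w.l.o.g. monic) polynomial over F has a root in F
  IsAlgClosed : Set (c ⊔ ℓ)
  IsAlgClosed = ∀ (as : List Carrier) → ∃ λ x → evalMonic as x ≈ 0#

  -- F has characteristic p0 (p0 prime is assumed separately): p0 · 1 = 0
  HasChar : ℕ → Set ℓ
  HasChar p0 = p0 · 1# ≈ 0#

  InPrimeField : Carrier → Set ℓ
  InPrimeField a = ∃ λ (n : ℕ) → a ≈ n · 1#

  IsAlgebraicOverPrimeField : Set (c ⊔ ℓ)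
  IsAlgebraicOverPrimeField =
    ∀ x → ∃ λ (as : List Carrier) → All InPrimeField as × (evalMonic as x ≈ 0#)

  IsAlgClosureOfPrimeField : ℕ → Set (c ⊔ ℓ)
  IsAlgClosureOfPrimeField p0 =
    IsField × HasChar p0 × IsAlgClosed × IsAlgebraicOverPrimeField

  -- membership in the subfield F_q = { x ∈ F | x^q = x }
  InFq : ℕ → Carrier → Set ℓ
  InFq q x = x ^ q ≈ x

  data Poly2 {s : Level} (S : Carrier → Set s) : Set (c ⊔ s) where
    var₁ var₂ : Poly2 S
    const     : (a : Carrier) → S a → Poly2 S
    _⊕_ _⊗_   : Poly2 S → Poly2 S → Poly2 S
    ⊝_        : Poly2 S → Poly2 S

  eval2 : {s : Level} {S : Carrier → Set s} → Poly2 S → Carrier → Carrier → Carrier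
  eval2 var₁        x y = x
  eval2 var₂        x y = y
  eval2 (const a _) x y = a
  eval2 (f ⊕ g)     x y = eval2 f x y + eval2 g x y
  eval2 (f ⊗ g)     x y = eval2 f x y * eval2 g x y
  eval2 (⊝ f)       x y = - eval2 f x y

  -- Isomorphism over S of the affine plane curves with point sets
  -- C = {(x,y) | P x y} and C' = {(x,y) | Q x y} (F-points, F algebraically closed):
  -- polynomial maps φ : C → C', ψ : C' → C with coefficients in S,
  -- mutually inverse on the curves.
  IsoOver : {s t : Level} (S : Carrier → Set s) →
            (P Q : Carrier → Carrier → Set t) → Set (c ⊔ ℓ ⊔ s ⊔ t)
  IsoOver S P Q =
    Σ (Poly2 S) λ φ₁ → Σ (Poly2 S) λ φ₂ → Σ (Poly2 S) λ ψ₁ → Σ (Poly2 S) λ ψ₂ →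
      (∀ x y → P x y → Q (eval2 φ₁ x y) (eval2 φ₂ x y))
    × (∀ x y → Q x y → P (eval2 ψ₁ x y) (eval2 ψ₂ x y))
    × (∀ x y → P x y →
         (eval2 ψ₁ (eval2 φ₁ x y) (eval2 φ₂ x y) ≈ x)
       × (eval2 ψ₂ (eval2 φ₁ x y) (eval2 φ₂ x y) ≈ y))
    × (∀ x y → Q x y →
         (eval2 φ₁ (eval2 ψ₁ x y) (eval2 ψ₂ x y) ≈ x)
       × (eval2 φ₂ (eval2 ψ₁ x y) (eval2 ψ₂ x y) ≈ y))

  R : ℕ → Carrier → Carrier
  R p x = (2 · (x ^ p)) + x

  CζR : ℕ → Carrier → Carrier → Carrier → Set ℓ
  CζR p ζ x z = (z ^ p) - z ≈ x * (ζ * R p x)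

  C′ : ℕ → Carrier → Carrier → Carrier → Carrier → Set ℓ
  C′ p ζ ξ x y = (y ^ p) - y ≈ - (ζ * ((ξ ^ (p Data.Nat.+ 1)) * (((x ^ p) - x) ^ 2)))

module Submission where

-- Write u = x/ξ and ℘ z = z^p - z, which is additive by the Frobenius. The substitution
-- (x , z) ↦ (u , z + B u²) with B = ζ(ξ^(p+1) + ξ²) adds ℘(B u²) = B^p u^(2p) - B u² to the
-- right-hand side x ζ R(x) = ζ(2 ξ^(p+1) u^(p+1) + ξ² u²); since B^p = ζ^p (ξ^(p²+p) + ξ^(2p))
-- and ζ^p ξ^(p²) + ζ^p ξ^p = -ζ ξ, the sum is -ζ ξ^(p+1) (u^p - u)². The inverse is
-- (u , y) ↦ (ξ u , y - B u²), and ξ⁻¹ and B lie in the subfield F_{p^d} with ξ and ζ.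

open import Defs
open import Algebra.Bundles using (CommutativeRing)
open import Data.Nat using (ℕ; _≤_)
open import Data.Nat.Primality using (Prime)
open import Data.Nat.Divisibility using (_∣_)
open import Relation.Binary.PropositionalEquality using (_≡_)
open import Relation.Nullary using (¬_)
import Data.Nat as ℕ

open import Level using (_⊔_; 0ℓ)
open import Algebra.Bundles.Raw using (RawRing)
open import Data.Nat using (zero; suc; _<_; _∸_; s≤s; z≤n)
import Data.Nat.Properties as ℕ
open import Data.Nat.Combinatorics using (_C_; nC1≡n; nCn≡1; nCk+nC[k+1]≡[n+1]C[k+1])
open import Data.Nat.Divisibility using (divides; ∣⇒≤)
open import Data.Nat.Primality using (euclidsLemma)
open import Data.Product using (_×_; _,_)
open import Data.Product.Properties using (≡-dec)
open import Data.Sum using (inj₁; inj₂)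
open import Data.Maybe using (Maybe; just; nothing)
open import Relation.Nullary using (yes; no; contradiction)
import Relation.Binary.PropositionalEquality as ≡
import Algebra.Solver.Ring
import Algebra.Solver.Ring.AlmostCommutativeRing as ACR

[1+k]*[1+n]C[1+k]≡[1+n]*nCk : ∀ n k → suc k ℕ.* (suc n C suc k) ≡ suc n ℕ.* (n C k)
[1+k]*[1+n]C[1+k]≡[1+n]*nCk zero    zero    = ≡.refl
[1+k]*[1+n]C[1+k]≡[1+n]*nCk zero    (suc k) = ℕ.*-zeroʳ (suc (suc k))
[1+k]*[1+n]C[1+k]≡[1+n]*nCk (suc n) zero    =
  ≡.trans (ℕ.+-identityʳ _) (≡.trans (nC1≡n (suc (suc n))) (≡.sym (ℕ.*-identityʳ (suc (suc n)))))
[1+k]*[1+n]C[1+k]≡[1+n]*nCk (suc n) (suc k) = begin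
    (2 ℕ.+ k) ℕ.* (suc (suc n) C suc (suc k))
  ≡⟨ ≡.cong ((2 ℕ.+ k) ℕ.*_) (≡.sym (nCk+nC[k+1]≡[n+1]C[k+1] (suc n) (suc k))) ⟩
    (2 ℕ.+ k) ℕ.* (A ℕ.+ B)
  ≡⟨ ℕ.*-distribˡ-+ (2 ℕ.+ k) A B ⟩
    (A ℕ.+ suc k ℕ.* A) ℕ.+ (2 ℕ.+ k) ℕ.* B
  ≡⟨ ≡.cong₂ (λ u v → (A ℕ.+ u) ℕ.+ v) ([1+k]*[1+n]C[1+k]≡[1+n]*nCk n k)
                                         ([1+k]*[1+n]C[1+k]≡[1+n]*nCk n (suc k)) ⟩
    (A ℕ.+ suc n ℕ.* (n C k)) ℕ.+ suc n ℕ.* (n C suc k)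
  ≡⟨ ℕ.+-assoc A _ _ ⟩
    A ℕ.+ (suc n ℕ.* (n C k) ℕ.+ suc n ℕ.* (n C suc k))
  ≡⟨ ≡.cong (A ℕ.+_) (≡.sym (ℕ.*-distribˡ-+ (suc n) (n C k) (n C suc k))) ⟩
    A ℕ.+ suc n ℕ.* ((n C k) ℕ.+ (n C suc k))
  ≡⟨ ≡.cong (λ u → A ℕ.+ suc n ℕ.* u) (nCk+nC[k+1]≡[n+1]C[k+1] n k) ⟩
    A ℕ.+ suc n ℕ.* A
  ∎
  where
  open ≡.≡-Reasoning
  A = suc n C suc k
  B = suc n C suc (suc k)

prime∣pCk : ∀ {p k} → Prime p → 0 < k → k < p → p ∣ p C k
prime∣pCk {suc n} {suc k} p-prime _ k<p
  with euclidsLemma (suc k) (suc n C suc k) p-prime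
         (divides (n C k) (≡.trans ([1+k]*[1+n]C[1+k]≡[1+n]*nCk n k) (ℕ.*-comm (suc n) (n C k))))
... | inj₁ p∣k   = contradiction (∣⇒≤ p∣k) (ℕ.<⇒≱ k<p)
... | inj₂ p∣pCk = p∣pCk

-- Algebra.Solver.Ring can only cancel x - x if its coefficients have decidable equality, which
-- an arbitrary commutative ring lacks; so the coefficients are taken in ℤ, mapped into F.
module IntegerCoefficientSolver {c ℓ} (F : CommutativeRing c ℓ) where
  open CommutativeRing F
  open import Algebra.Properties.Ring ring using (-‿distribˡ-*; -‿distribʳ-*)
  open import Algebra.Properties.AbelianGroup +-abelianGroup
    using (⁻¹-∙-comm; ⁻¹-involutive; ⁻¹-anti-homo‿-; //-rightDividesʳ)
  open import Algebra.Properties.CommutativeSemigroup +-commutativeSemigroup using (interchange)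
  open import Algebra.Properties.Semiring.Mult semiring using (×-homo-+; ×1-homo-*) renaming (_×_ to _·_)
  open import Relation.Binary.Reasoning.Setoid setoid

  -- (m , n) stands for the integer m - n.
  Difference : Set
  Difference = ℕ × ℕ

  normalise : Difference → Difference
  normalise (m , n) = m ∸ n , n ∸ m

  ⟦_⟧ : Difference → Carrier
  ⟦ m , n ⟧ = m · 1# - n · 1#

  differences : RawRing 0ℓ 0ℓ
  differences = record
    { Carrier = Difference
    ; _≈_     = _≡_
    ; _+_     = λ { (a , b) (c , d) → normalise (a ℕ.+ c , b ℕ.+ d) }
    ; _*_     = λ { (a , b) (c , d) → normalise (a ℕ.* c ℕ.+ b ℕ.* d , a ℕ.* d ℕ.+ b ℕ.* c) }
    ; -_      = λ { (a , b) → b , a }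
    ; 0#      = 0 , 0
    ; 1#      = 1 , 0
    }

  -‿distrib-+ : ∀ x y → - (x + y) ≈ - x + - y
  -‿distrib-+ x y = sym (⁻¹-∙-comm x y)

  ⟦normalise⟧ : ∀ m n → ⟦ normalise (m , n) ⟧ ≈ ⟦ m , n ⟧
  ⟦normalise⟧ zero    zero    = refl
  ⟦normalise⟧ zero    (suc n) = refl
  ⟦normalise⟧ (suc m) zero    = refl
  ⟦normalise⟧ (suc m) (suc n) = begin
    ⟦ normalise (m , n) ⟧          ≈⟨ ⟦normalise⟧ m n ⟩
    M - N                         ≈⟨ +-identityˡ (M - N) ⟨
    0# + (M - N)                  ≈⟨ +-congʳ (-‿inverseʳ 1#) ⟨
    (1# - 1#) + (M - N)           ≈⟨ interchange 1# M (- 1#) (- N) ⟨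
    (1# + M) + (- 1# + - N)       ≈⟨ +-congˡ (-‿distrib-+ 1# N) ⟨
    (1# + M) - (1# + N)           ∎
    where
    M = m · 1#
    N = n · 1#

  ⟦⟧-+-homo : ∀ a b c d → ⟦ normalise (a ℕ.+ c , b ℕ.+ d) ⟧ ≈ ⟦ a , b ⟧ + ⟦ c , d ⟧
  ⟦⟧-+-homo a b c d = begin
    ⟦ normalise (a ℕ.+ c , b ℕ.+ d) ⟧   ≈⟨ ⟦normalise⟧ (a ℕ.+ c) (b ℕ.+ d) ⟩
    (a ℕ.+ c) · 1# - (b ℕ.+ d) · 1#     ≈⟨ +-cong (×-homo-+ 1# a c) (-‿cong (×-homo-+ 1# b d)) ⟩
    (a′ + c′) - (b′ + d′)               ≈⟨ +-congˡ (-‿distrib-+ b′ d′) ⟩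
    (a′ + c′) + (- b′ + - d′)           ≈⟨ interchange a′ c′ (- b′) (- d′) ⟩
    (a′ - b′) + (c′ - d′)               ∎
    where
    a′ = a · 1#
    b′ = b · 1#
    c′ = c · 1#
    d′ = d · 1#

  [a-b]*[c-d] : ∀ a b c d → (a - b) * (c - d) ≈ (a * c + b * d) - (a * d + b * c)
  [a-b]*[c-d] a b c d = begin
    (a - b) * (c - d)                         ≈⟨ distribʳ (c - d) a (- b) ⟩
    a * (c - d) + - b * (c - d)               ≈⟨ +-cong (distribˡ a c (- d)) (distribˡ (- b) c (- d)) ⟩
    (a * c + a * - d) + (- b * c + - b * - d) ≈⟨ +-cong (+-congˡ (-‿distribʳ-* a d))
                                                        (+-cong (-‿distribˡ-* b c) (sym -b*-d≈b*d)) ⟨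
    (a * c - a * d) + (- (b * c) + b * d)     ≈⟨ +-congˡ (+-comm (- (b * c)) (b * d)) ⟩
    (a * c - a * d) + (b * d - b * c)         ≈⟨ interchange (a * c) (b * d) (- (a * d)) (- (b * c)) ⟨
    (a * c + b * d) + (- (a * d) + - (b * c)) ≈⟨ +-congˡ (-‿distrib-+ (a * d) (b * c)) ⟨
    (a * c + b * d) - (a * d + b * c)         ∎
    where
    -b*-d≈b*d : - b * - d ≈ b * d
    -b*-d≈b*d = begin
      - b * - d     ≈⟨ -‿distribˡ-* b (- d) ⟨
      - (b * - d)   ≈⟨ -‿cong (-‿distribʳ-* b d) ⟨
      - - (b * d)   ≈⟨ ⁻¹-involutive (b * d) ⟩
      b * d         ∎

  ⟦⟧-*-homo : ∀ a b c d →
    ⟦ normalise (a ℕ.* c ℕ.+ b ℕ.* d , a ℕ.* d ℕ.+ b ℕ.* c) ⟧ ≈ ⟦ a , b ⟧ * ⟦ c , d ⟧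
  ⟦⟧-*-homo a b c d = begin
    ⟦ normalise (a ℕ.* c ℕ.+ b ℕ.* d , a ℕ.* d ℕ.+ b ℕ.* c) ⟧
      ≈⟨ ⟦normalise⟧ (a ℕ.* c ℕ.+ b ℕ.* d) (a ℕ.* d ℕ.+ b ℕ.* c) ⟩
    (a ℕ.* c ℕ.+ b ℕ.* d) · 1# - (a ℕ.* d ℕ.+ b ℕ.* c) · 1#
      ≈⟨ +-cong (×-homo-+ 1# (a ℕ.* c) (b ℕ.* d)) (-‿cong (×-homo-+ 1# (a ℕ.* d) (b ℕ.* c))) ⟩
    ((a ℕ.* c) · 1# + (b ℕ.* d) · 1#) - ((a ℕ.* d) · 1# + (b ℕ.* c) · 1#)
      ≈⟨ +-cong (+-cong (×1-homo-* a c) (×1-homo-* b d))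
                (-‿cong (+-cong (×1-homo-* a d) (×1-homo-* b c))) ⟩
    (a′ * c′ + b′ * d′) - (a′ * d′ + b′ * c′)
      ≈⟨ [a-b]*[c-d] a′ b′ c′ d′ ⟨
    (a′ - b′) * (c′ - d′) ∎
    where
    a′ = a · 1#
    b′ = b · 1#
    c′ = c · 1#
    d′ = d · 1#

  ⟦⟧-homomorphism : ACR._-Raw-AlmostCommutative⟶_ differences (ACR.fromCommutativeRing F)
  ⟦⟧-homomorphism = record
    { ⟦_⟧    = ⟦_⟧
    ; +-homo = λ { (a , b) (c , d) → ⟦⟧-+-homo a b c d }
    ; *-homo = λ { (a , b) (c , d) → ⟦⟧-*-homo a b c d }
    ; -‿homo = λ { (a , b) → sym (⁻¹-anti-homo‿- (a · 1#) (b · 1#)) }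
    ; 0-homo = -‿inverseʳ 0#
    ; 1-homo = //-rightDividesʳ 0# 1#
    }

  _≟-⟦⟧_ : ∀ x y → Maybe (⟦ x ⟧ ≈ ⟦ y ⟧)
  x ≟-⟦⟧ y with ≡-dec ℕ._≟_ ℕ._≟_ x y
  ... | yes ≡.refl = just refl
  ... | no  _      = nothing

  open Algebra.Solver.Ring differences (ACR.fromCommutativeRing F) ⟦⟧-homomorphism _≟-⟦⟧_ public
    using (solve; _:=_; _:+_; _:*_; _:-_)

module PowerLaws {c ℓ} (F : CommutativeRing c ℓ) where
  open CommutativeRing F
  open FieldDefs F using (_^_)
  import Algebra.Properties.CommutativeSemiring.Exp commutativeSemiring as Exp
  open import Algebra.Properties.Ring ring using (x+x≈x⇒x≈0)
  open import Algebra.Properties.AbelianGroup +-abelianGroup using (inverseʳ-unique)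
  open import Relation.Binary.Reasoning.Setoid setoid

  ^≡^ : ∀ a n → a ^ n ≡ a Exp.^ n
  ^≡^ a zero    = ≡.refl
  ^≡^ a (suc n) = ≡.cong (a *_) (^≡^ a n)

  ^-congˡ : ∀ n {a b} → a ≈ b → a ^ n ≈ b ^ n
  ^-congˡ n {a} {b} rewrite ^≡^ a n | ^≡^ b n = Exp.^-congˡ n

  ^-distrib-* : ∀ a b n → (a * b) ^ n ≈ a ^ n * b ^ n
  ^-distrib-* a b n rewrite ^≡^ (a * b) n | ^≡^ a n | ^≡^ b n = Exp.^-distrib-* a b n

  ^-homo-* : ∀ a m n → a ^ (m ℕ.+ n) ≈ a ^ m * a ^ n
  ^-homo-* a m n rewrite ^≡^ a (m ℕ.+ n) | ^≡^ a m | ^≡^ a n = Exp.^-homo-* a m n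

  ^-assocʳ : ∀ a m n → (a ^ m) ^ n ≈ a ^ (m ℕ.* n)
  ^-assocʳ a m n rewrite ^≡^ a m | ^≡^ (a Exp.^ m) n | ^≡^ a (m ℕ.* n) = Exp.^-assocʳ a m n

  1^n≈1 : ∀ n → 1# ^ n ≈ 1#
  1^n≈1 zero    = refl
  1^n≈1 (suc n) = trans (*-identityˡ _) (1^n≈1 n)

  AdditivePower : ℕ → Set (c ⊔ ℓ)
  AdditivePower n = ∀ a b → (a + b) ^ n ≈ a ^ n + b ^ n

  additivePower-^ : ∀ {p} → AdditivePower p → ∀ k → AdditivePower (p ℕ.^ k)
  additivePower-^     additive zero    a b = distribʳ 1# a b
  additivePower-^ {p} additive (suc k) a b = begin
    (a + b) ^ (p ℕ.* q)          ≈⟨ ^-assocʳ (a + b) p q ⟨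
    ((a + b) ^ p) ^ q            ≈⟨ ^-congˡ q (additive a b) ⟩
    (a ^ p + b ^ p) ^ q          ≈⟨ additivePower-^ additive k (a ^ p) (b ^ p) ⟩
    (a ^ p) ^ q + (b ^ p) ^ q    ≈⟨ +-cong (^-assocʳ a p q) (^-assocʳ b p q) ⟩
    a ^ (p ℕ.* q) + b ^ (p ℕ.* q) ∎
    where q = p ℕ.^ k

  module _ {p} (additive : AdditivePower p) where

    0^p≈0 : 0# ^ p ≈ 0#
    0^p≈0 = x+x≈x⇒x≈0 (0# ^ p) (begin
      0# ^ p + 0# ^ p   ≈⟨ additive 0# 0# ⟨
      (0# + 0#) ^ p     ≈⟨ ^-congˡ p (+-identityʳ 0#) ⟩
      0# ^ p            ∎)

    -‿^p : ∀ a → (- a) ^ p ≈ - (a ^ p)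
    -‿^p a = inverseʳ-unique (a ^ p) ((- a) ^ p) (begin
      a ^ p + (- a) ^ p   ≈⟨ additive a (- a) ⟨
      (a - a) ^ p         ≈⟨ ^-congˡ p (-‿inverseʳ a) ⟩
      0# ^ p              ≈⟨ 0^p≈0 ⟩
      0#                  ∎)

module Frobenius {c ℓ} (F : CommutativeRing c ℓ) where
  open CommutativeRing F hiding (zero)
  open FieldDefs F using (_·_; HasChar)
  open PowerLaws F using (^≡^; AdditivePower)
  open import Algebra.Properties.CommutativeSemiring.Binomial commutativeSemiring
    using (theorem; binomialTerm)
  open import Algebra.Properties.Semiring.Exp semiring using (_^_)
  open import Algebra.Properties.Semiring.Mult semiring
    using (×-congʳ; ×-assoc-*; ×1-homo-*) renaming (_×_ to _×′_)
  open import Algebra.Properties.Monoid.Sum +-monoid using (sum; sum-cong-≋; sum-init-last; sum-replicate-zero)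
  open import Data.Fin using (Fin; inject₁; fromℕ)
  import Data.Fin as Fin
  open import Data.Fin.Properties using (toℕ-fromℕ; toℕ-inject₁; toℕ<n)
  open import Relation.Binary.Reasoning.Setoid setoid

  ·≡× : ∀ n a → n · a ≡ n ×′ a
  ·≡× zero    a = ≡.refl
  ·≡× (suc n) a = ≡.cong (a +_) (·≡× n a)

  char∣⇒×≈0 : ∀ {p n} → HasChar p → p ∣ n → ∀ a → n ×′ a ≈ 0#
  char∣⇒×≈0 {p} char (divides q ≡.refl) a = begin
    (q ℕ.* p) ×′ a                  ≈⟨ ×-congʳ (q ℕ.* p) (*-identityˡ a) ⟨
    (q ℕ.* p) ×′ (1# * a)           ≈⟨ ×-assoc-* (q ℕ.* p) 1# a ⟨
    ((q ℕ.* p) ×′ 1#) * a           ≈⟨ *-congʳ (×1-homo-* q p) ⟩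
    ((q ×′ 1#) * (p ×′ 1#)) * a     ≈⟨ *-congʳ (*-congˡ p×1≈0) ⟩
    ((q ×′ 1#) * 0#) * a            ≈⟨ *-congʳ (zeroʳ (q ×′ 1#)) ⟩
    0# * a                          ≈⟨ zeroˡ a ⟩
    0#                              ∎
    where
    p×1≈0 : p ×′ 1# ≈ 0#
    p×1≈0 = ≡.subst (_≈ 0#) (·≡× p 1#) char

  -- Only the two extreme terms of the binomial expansion survive: p divides the others.
  frobenius : ∀ {p} → Prime p → HasChar p → AdditivePower p
  frobenius {suc m} p-prime char a b
    rewrite ^≡^ (a + b) (suc m) | ^≡^ a (suc m) | ^≡^ b (suc m) = begin
    (a + b) ^ suc m                                         ≈⟨ theorem (suc m) a b ⟩
    term Fin.zero + sum (λ i → term (Fin.suc i))            ≈⟨ +-congˡ (sum-init-last (λ i → term (Fin.suc i))) ⟩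
    term Fin.zero + (sum (λ i → term (Fin.suc (inject₁ i))) + term (fromℕ (suc m)))
      ≈⟨ +-cong first-term (+-cong (trans (sum-cong-≋ middle-terms) (sum-replicate-zero m)) last-term) ⟩
    b ^ suc m + (0# + a ^ suc m)                            ≈⟨ +-congˡ (+-identityˡ (a ^ suc m)) ⟩
    b ^ suc m + a ^ suc m                                   ≈⟨ +-comm (b ^ suc m) (a ^ suc m) ⟩
    a ^ suc m + b ^ suc m                                   ∎
    where
    term : Fin (suc (suc m)) → Carrier
    term = binomialTerm a b (suc m)
    first-term : term Fin.zero ≈ b ^ suc m
    first-term = trans (+-identityʳ _) (*-identityˡ _)
    last-term : term (fromℕ (suc m)) ≈ a ^ suc m
    last-term rewrite toℕ-fromℕ m | nCn≡1 (suc m) | ℕ.n∸n≡0 m = trans (+-identityʳ _) (*-identityʳ _)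
    middle-terms : ∀ (i : Fin m) → term (Fin.suc (inject₁ i)) ≈ 0#
    middle-terms i = char∣⇒×≈0 char (prime∣pCk p-prime (s≤s z≤n)
      (s≤s (≡.subst (_< m) (≡.sym (toℕ-inject₁ i)) (toℕ<n i)))) _

module FiniteSubfield {c ℓ} (F : CommutativeRing c ℓ) (q : ℕ) where
  open CommutativeRing F
  open FieldDefs F using (_^_; InFq)
  open PowerLaws F
  open import Relation.Binary.Reasoning.Setoid setoid

  InFq-+ : AdditivePower q → ∀ {a b} → InFq q a → InFq q b → InFq q (a + b)
  InFq-+ additive a∈ b∈ = trans (additive _ _) (+-cong a∈ b∈)

  InFq-* : ∀ {a b} → InFq q a → InFq q b → InFq q (a * b)
  InFq-* {a} {b} a∈ b∈ = trans (^-distrib-* a b q) (*-cong a∈ b∈)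

  InFq-^ : ∀ {a} → InFq q a → ∀ n → InFq q (a ^ n)
  InFq-^ {a} a∈ n = begin
    (a ^ n) ^ q    ≈⟨ ^-assocʳ a n q ⟩
    a ^ (n ℕ.* q)  ≡⟨ ≡.cong (a ^_) (ℕ.*-comm n q) ⟩
    a ^ (q ℕ.* n)  ≈⟨ ^-assocʳ a q n ⟨
    (a ^ q) ^ n    ≈⟨ ^-congˡ n a∈ ⟩
    a ^ n          ∎

  InFq-inverse : ∀ {a b} → a * b ≈ 1# → InFq q a → InFq q b
  InFq-inverse {a} {b} ab≈1 a∈ = begin
    b ^ q                ≈⟨ *-identityʳ (b ^ q) ⟨
    b ^ q * 1#           ≈⟨ *-congˡ ab≈1 ⟨
    b ^ q * (a * b)      ≈⟨ *-assoc (b ^ q) a b ⟨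
    (b ^ q * a) * b      ≈⟨ *-congʳ (*-comm (b ^ q) a) ⟩
    (a * b ^ q) * b      ≈⟨ *-congʳ (*-congʳ a∈) ⟨
    (a ^ q * b ^ q) * b  ≈⟨ *-congʳ (^-distrib-* a b q) ⟨
    (a * b) ^ q * b      ≈⟨ *-congʳ (trans (^-congˡ q ab≈1) (1^n≈1 q)) ⟩
    1# * b               ≈⟨ *-identityˡ b ⟩
    b                    ∎

module ArtinSchreierTwist {c ℓ} (F : CommutativeRing c ℓ) where
  open CommutativeRing F
  open FieldDefs F
  open PowerLaws F
  open IntegerCoefficientSolver F using (solve; _:=_; _:+_; _:*_; _:-_)
  open import Algebra.Properties.AbelianGroup +-abelianGroup
    using (⁻¹-∙-comm; //-rightDividesˡ; //-rightDividesʳ)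
  open import Algebra.Properties.CommutativeSemigroup +-commutativeSemigroup using (interchange)
  open import Relation.Binary.Reasoning.Setoid setoid

  twist-polynomial-identity : ∀ U Uᵖ ξ ξᵖ ξᵖᵖ ζ ζᵖ →
    (ξ * U) * (ζ * ((ξᵖ * Uᵖ + ξᵖ * Uᵖ) + ξ * U))
      + ((ζᵖ * (ξᵖᵖ * ξᵖ + ξᵖ * ξᵖ)) * (Uᵖ * Uᵖ) - (ζ * (ξᵖ * ξ + ξ * ξ)) * (U * U))
    ≈ (ξᵖ * (Uᵖ * Uᵖ)) * ((ζᵖ * ξᵖᵖ + ζᵖ * ξᵖ) + ζ * ξ)
      - ζ * ((ξᵖ * ξ) * ((Uᵖ - U) * (Uᵖ - U)))
  twist-polynomial-identity = solve 7 (λ U Uᵖ ξ ξᵖ ξᵖᵖ ζ ζᵖ →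
      (ξ :* U) :* (ζ :* ((ξᵖ :* Uᵖ :+ ξᵖ :* Uᵖ) :+ ξ :* U))
        :+ ((ζᵖ :* (ξᵖᵖ :* ξᵖ :+ ξᵖ :* ξᵖ)) :* (Uᵖ :* Uᵖ) :- (ζ :* (ξᵖ :* ξ :+ ξ :* ξ)) :* (U :* U))
      := (ξᵖ :* (Uᵖ :* Uᵖ)) :* ((ζᵖ :* ξᵖᵖ :+ ζᵖ :* ξᵖ) :+ ζ :* ξ)
        :- ζ :* ((ξᵖ :* ξ) :* ((Uᵖ :- U) :* (Uᵖ :- U))))
    refl

  twist-coefficient : ℕ → Carrier → Carrier → Carrier
  twist-coefficient p ζ ξ = ζ * (ξ ^ (p ℕ.+ 1) + ξ * ξ)

  module _ (p : ℕ) (additive : AdditivePower p) where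

    ℘ : Carrier → Carrier
    ℘ a = a ^ p - a

    ℘-+ : ∀ a b → ℘ (a + b) ≈ ℘ a + ℘ b
    ℘-+ a b = begin
      (a + b) ^ p - (a + b)          ≈⟨ +-cong (additive a b) (sym (⁻¹-∙-comm a b)) ⟩
      (a ^ p + b ^ p) + (- a + - b)  ≈⟨ interchange (a ^ p) (b ^ p) (- a) (- b) ⟩
      ℘ a + ℘ b                      ∎

    ℘-- : ∀ a b → ℘ (a - b) ≈ ℘ a - ℘ b
    ℘-- a b = begin
      ℘ (a - b)                ≈⟨ ℘-+ a (- b) ⟩
      ℘ a + ((- b) ^ p - - b)  ≈⟨ +-congˡ (+-congʳ (-‿^p {p} additive b)) ⟩
      ℘ a + (- b ^ p - - b)    ≈⟨ +-congˡ (⁻¹-∙-comm (b ^ p) (- b)) ⟩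
      ℘ a - ℘ b                ∎

    R-cong : ∀ {a b} → a ≈ b → R p a ≈ R p b
    R-cong {a} {b} a≈b = +-cong (+-cong a^p≈b^p (+-congʳ a^p≈b^p)) a≈b
      where
      a^p≈b^p : a ^ p ≈ b ^ p
      a^p≈b^p = ^-congˡ p a≈b

    module _ (ζ ξ : Carrier)
             (H : ((ζ ^ p) * (ξ ^ (p ℕ.* p))) + ((ζ ^ p) * (ξ ^ p)) + (ζ * ξ) ≈ 0#) where

      private
        B : Carrier
        B = twist-coefficient p ζ ξ

      ξ^[p+1]≈ξ^p*ξ : ξ ^ (p ℕ.+ 1) ≈ ξ ^ p * ξ
      ξ^[p+1]≈ξ^p*ξ = trans (^-homo-* ξ p 1) (*-congˡ (*-identityʳ ξ))

      B^p : B ^ p ≈ ζ ^ p * (ξ ^ (p ℕ.* p) * ξ ^ p + ξ ^ p * ξ ^ p)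
      B^p = begin
        (ζ * (ξ ^ (p ℕ.+ 1) + ξ * ξ)) ^ p              ≈⟨ ^-distrib-* ζ _ p ⟩
        ζ ^ p * (ξ ^ (p ℕ.+ 1) + ξ * ξ) ^ p            ≈⟨ *-congˡ (additive _ _) ⟩
        ζ ^ p * ((ξ ^ (p ℕ.+ 1)) ^ p + (ξ * ξ) ^ p)    ≈⟨ *-congˡ (+-cong ξ^[p+1]^p (^-distrib-* ξ ξ p)) ⟩
        ζ ^ p * (ξ ^ (p ℕ.* p) * ξ ^ p + ξ ^ p * ξ ^ p) ∎
        where
        ξ^[p+1]^p : (ξ ^ (p ℕ.+ 1)) ^ p ≈ ξ ^ (p ℕ.* p) * ξ ^ p
        ξ^[p+1]^p = begin
          (ξ ^ (p ℕ.+ 1)) ^ p      ≈⟨ ^-congˡ p ξ^[p+1]≈ξ^p*ξ ⟩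
          (ξ ^ p * ξ) ^ p          ≈⟨ ^-distrib-* (ξ ^ p) ξ p ⟩
          (ξ ^ p) ^ p * ξ ^ p      ≈⟨ *-congʳ (^-assocʳ ξ p p) ⟩
          ξ ^ (p ℕ.* p) * ξ ^ p    ∎

      twist-identity : ∀ U →
        (ξ * U) * (ζ * R p (ξ * U)) + ℘ (B * (U * U))
        ≈ - (ζ * (ξ ^ (p ℕ.+ 1) * ((U ^ p - U) ^ 2)))
      twist-identity U = begin
        (ξ * U) * (ζ * R p (ξ * U)) + ((B * (U * U)) ^ p - B * (U * U))
          ≈⟨ +-cong (*-congˡ (*-congˡ R[ξU])) (+-cong [BUU]^p (-‿cong (*-congʳ B≈ζ*[ξᵖ*ξ+ξ*ξ]))) ⟩
        (ξ * U) * (ζ * ((ξᵖ * Uᵖ + ξᵖ * Uᵖ) + ξ * U))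
          + ((ζ ^ p * (ξ ^ (p ℕ.* p) * ξᵖ + ξᵖ * ξᵖ)) * (Uᵖ * Uᵖ) - (ζ * (ξᵖ * ξ + ξ * ξ)) * (U * U))
          ≈⟨ twist-polynomial-identity U Uᵖ ξ ξᵖ (ξ ^ (p ℕ.* p)) ζ (ζ ^ p) ⟩
        (ξᵖ * (Uᵖ * Uᵖ)) * ((ζ ^ p * ξ ^ (p ℕ.* p) + ζ ^ p * ξᵖ) + ζ * ξ) - ζ * ((ξᵖ * ξ) * (V * V))
          ≈⟨ +-congʳ (trans (*-congˡ H) (zeroʳ _)) ⟩
        0# - ζ * ((ξᵖ * ξ) * (V * V))
          ≈⟨ +-identityˡ _ ⟩
        - (ζ * ((ξᵖ * ξ) * (V * V)))
          ≈⟨ -‿cong (*-congˡ (*-cong (sym ξ^[p+1]≈ξ^p*ξ) (*-congˡ (sym (*-identityʳ V))))) ⟩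
        - (ζ * (ξ ^ (p ℕ.+ 1) * (V ^ 2)))  ∎
        where
        ξᵖ = ξ ^ p
        Uᵖ = U ^ p
        V = Uᵖ - U
        R[ξU] : R p (ξ * U) ≈ (ξᵖ * Uᵖ + ξᵖ * Uᵖ) + ξ * U
        R[ξU] = +-congʳ (trans (+-congˡ (+-identityʳ _)) (+-cong [ξU]^p [ξU]^p))
          where
          [ξU]^p : (ξ * U) ^ p ≈ ξᵖ * Uᵖ
          [ξU]^p = ^-distrib-* ξ U p
        [BUU]^p : (B * (U * U)) ^ p ≈ (ζ ^ p * (ξ ^ (p ℕ.* p) * ξᵖ + ξᵖ * ξᵖ)) * (Uᵖ * Uᵖ)
        [BUU]^p = trans (^-distrib-* B (U * U) p) (*-cong B^p (^-distrib-* U U p))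
        B≈ζ*[ξᵖ*ξ+ξ*ξ] : B ≈ ζ * (ξᵖ * ξ + ξ * ξ)
        B≈ζ*[ξᵖ*ξ+ξ*ξ] = *-congˡ (+-congʳ ξ^[p+1]≈ξ^p*ξ)

      module _ (w : Carrier) (ξw≈1 : ξ * w ≈ 1#) where

        ξ*[w*x]≈x : ∀ x → ξ * (w * x) ≈ x
        ξ*[w*x]≈x x = trans (sym (*-assoc ξ w x)) (trans (*-congʳ ξw≈1) (*-identityˡ x))

        w*[ξ*u]≈u : ∀ u → w * (ξ * u) ≈ u
        w*[ξ*u]≈u u = trans (sym (*-assoc w ξ u)) (trans (*-congʳ (trans (*-comm w ξ) ξw≈1)) (*-identityˡ u))

        twist-maps-CζR-to-C′ : ∀ x z → CζR p ζ x z → C′ p ζ ξ (w * x) (z + B * ((w * x) * (w * x)))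
        twist-maps-CζR-to-C′ x z on-CζR = begin
          ℘ (z + B * (U * U))                           ≈⟨ ℘-+ z (B * (U * U)) ⟩
          ℘ z + ℘ (B * (U * U))                         ≈⟨ +-congʳ on-CζR ⟩
          x * (ζ * R p x) + ℘ (B * (U * U))             ≈⟨ +-congʳ (*-cong x≈ξU (*-congˡ (R-cong x≈ξU))) ⟩
          (ξ * U) * (ζ * R p (ξ * U)) + ℘ (B * (U * U)) ≈⟨ twist-identity U ⟩
          - (ζ * (ξ ^ (p ℕ.+ 1) * ((U ^ p - U) ^ 2)))   ∎
          where
          U = w * x
          x≈ξU : x ≈ ξ * U
          x≈ξU = sym (ξ*[w*x]≈x x)

        twist⁻¹-maps-C′-to-CζR : ∀ u y → C′ p ζ ξ u y → CζR p ζ (ξ * u) (y - B * (u * u))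
        twist⁻¹-maps-C′-to-CζR u y on-C′ = begin
          ℘ (y - B * (u * u))
            ≈⟨ ℘-- y (B * (u * u)) ⟩
          ℘ y - ℘ (B * (u * u))
            ≈⟨ +-congʳ (trans on-C′ (sym (twist-identity u))) ⟩
          ((ξ * u) * (ζ * R p (ξ * u)) + ℘ (B * (u * u))) - ℘ (B * (u * u))
            ≈⟨ //-rightDividesʳ _ _ ⟩
          (ξ * u) * (ζ * R p (ξ * u))  ∎

        twist-iso : ∀ {s} (S : Carrier → Set s) → S w → S ξ → S B → IsoOver S (CζR p ζ) (C′ p ζ ξ)
        twist-iso S w∈S ξ∈S B∈S =
          φ₁ , φ₂ , ψ₁ , ψ₂ ,
          twist-maps-CζR-to-C′ , twist⁻¹-maps-C′-to-CζR ,
          (λ x z _ → ξ*[w*x]≈x x , //-rightDividesʳ _ z) ,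
          (λ u y _ → w*[ξ*u]≈u u ,
             trans (+-congˡ (*-congˡ (*-cong (w*[ξ*u]≈u u) (w*[ξ*u]≈u u)))) (//-rightDividesˡ _ y))
          where
          φ₁ φ₂ ψ₁ ψ₂ : Poly2 S
          φ₁ = const w w∈S ⊗ var₁
          φ₂ = var₂ ⊕ (const B B∈S ⊗ (φ₁ ⊗ φ₁))
          ψ₁ = const ξ ξ∈S ⊗ var₁
          ψ₂ = var₂ ⊕ (⊝ (const B B∈S ⊗ (var₁ ⊗ var₁)))

lemma7p1 : ∀ {c ℓ} (F : CommutativeRing c ℓ) →
  let open CommutativeRing F
      open FieldDefs F
  in (p₀ : ℕ) → Prime p₀ → ¬ (2 ∣ p₀) →
     IsAlgClosureOfPrimeField p₀ →
     (k : ℕ) → 1 ≤ k → (p : ℕ) → p ≡ p₀ ℕ.^ k →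
     (ζ : Carrier) → ¬ (ζ ≈ 0#) →
     (ξ : Carrier) → ¬ (ξ ≈ 0#) →
     ((ζ ^ p) * (ξ ^ (p ℕ.* p))) + ((ζ ^ p) * (ξ ^ p)) + (ζ * ξ) ≈ 0# →
     (d : ℕ) → 1 ≤ d → InFq (p ℕ.^ d) ξ → InFq (p ℕ.^ d) ζ →
     IsoOver (InFq (p ℕ.^ d)) (CζR p ζ) (C′ p ζ ξ)
lemma7p1 F p₀ p₀-prime _ ((_ , invertible) , char , _) k _ _ ≡.refl ζ _ ξ ξ≢0 H d _ ξ∈Fq ζ∈Fq
  with invertible ξ ξ≢0
... | w , ξw≈1 = twist-iso p p-additive ζ ξ H w ξw≈1 (InFq q)
                   (InFq-inverse ξw≈1 ξ∈Fq) ξ∈Fq B∈Fq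
  where
  p q : ℕ
  p = p₀ ℕ.^ k
  q = p ℕ.^ d
  open FieldDefs F using (InFq)
  open PowerLaws F using (AdditivePower; additivePower-^)
  open Frobenius F using (frobenius)
  open FiniteSubfield F q
  open ArtinSchreierTwist F using (twist-iso; twist-coefficient)
  p-additive : AdditivePower p
  p-additive = additivePower-^ (frobenius p₀-prime char) k
  B∈Fq : InFq q (twist-coefficient p ζ ξ)
  B∈Fq = InFq-* ζ∈Fq (InFq-+ (additivePower-^ p-additive d) (InFq-^ ξ∈Fq (p ℕ.+ 1)) (InFq-* ξ∈Fq ξ∈Fq))
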